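{- Let $V$ be a finite set of $n\ge1$ vertices with a metric $d$ (i.e. $d_{ij}\ge 0$, $d_{ii}=0$, $d_{ij}=d_{ji}$, $d_{hi}+d_{ij}\ge d_{hj}$ for all $h,i,j\in V$), and let $k\ge 1$ and $0\le q<n$ be integers. Run the following procedure (Algorithm 2): start with $P:=V$, $S:=\emptyset$; while $P\neq\emptyset$ and $|S|<k$, choose $s\in P$ with $s\in\arg\min_{i\in P} NR_q(i)$ (ties broken arbitrarily), set $S:=S\cup\{s\}$ and $P:=\{i\in P: d_{is}>2\,NR_q(i)\}$. Finally set $O:=P$ and, for each $i\in V\setminus O$, let $\sigma(i)\in\arg\min_{h\in S} d_{ih}$. Then the output $(S,O,\sigma)$ is a feasible solution of the IF$k$CO instance $(V,d,k,q)$, i.e. $|S|\le k$ and $|O|\le q$.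
   Context: For $i\in V$, $NR_q(i)$ (the outlier-related neighborhood radius) is the distance from $i$ to its $\lceil (n-q)/k\rceil$-th nearest neighbour in $V$, where vertices are ordered by nondecreasing distance from $i$ and $i$ itself counts as its own (first) nearest neighbour. In the individually fair $k$-center with outliers (IF$k$CO) on instance $(V,d,k,q)$, a solution is a triple $(S,O,\sigma)$ with $S\subseteq V$ (centers), $O\subseteq V$ (outliers) and $\sigma:V\setminus O\to S$; it is feasible if $|S|\le k$ and $|O|\le q$.
   Formalization: The distances $d_{ij}$ of the metric d are rational. -}

module Defs where

open import Data.Nat as ℕ using (ℕ; zero; suc; _∸_; _/_)
open import Data.Fin using (Fin)
open import Data.Fin.Subset using (Subset; _∈_; _∉_; _∪_; ⁅_⁆; ∣_∣; Nonempty; Empty)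
open import Data.List using (List; []; _∷_; map; allFin)
open import Data.Rational using (ℚ; 0ℚ; _≤_; _<_; _+_)
open import Data.Rational.Properties using (≤-decTotalOrder)
open import Data.List.Sort ≤-decTotalOrder using (sort)
open import Data.Product using (_×_; proj₁)
open import Data.Sum using (_⊎_)
open import Function.Bundles using (_⇔_)
open import Relation.Binary.PropositionalEquality using (_≡_)

record IsMetric {n : ℕ} (d : Fin n → Fin n → ℚ) : Set where
  field
    nonneg : ∀ i j → 0ℚ ≤ d i j
    refl0  : ∀ i → d i i ≡ 0ℚ
    symm   : ∀ i j → d i j ≡ d j i
    tri    : ∀ h i j → d h j ≤ d h i + d i j

-- ceiling division ⌈ a / k ⌉ (only used with k ≥ 1; value for k = 0 is irrelevant)
⌈_/_⌉ : ℕ → ℕ → ℕ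
⌈ a / zero ⌉ = 0
⌈ a / suc k ⌉ = (a ℕ.+ k) / suc k

nth : ℚ → List ℚ → ℕ → ℚ
nth dflt []       _       = dflt
nth dflt (x ∷ xs) zero    = x
nth dflt (x ∷ xs) (suc m) = nth dflt xs m

-- NR_q(i): distance from i to its ⌈(n-q)/k⌉-th nearest neighbour (1-indexed,
-- i itself counting as the first), i.e. the ⌈(n-q)/k⌉-th smallest entry of
-- the multiset { d i j | j ∈ V } (sorted nondecreasingly).
NR : {n : ℕ} → (Fin n → Fin n → ℚ) → (k q : ℕ) → Fin n → ℚ
NR {n} d k q i = nth 0ℚ (sort (map (d i) (allFin n))) (⌈ (n ∸ q) / k ⌉ ∸ 1)

-- Executions of Algorithm 2 (nondeterministic due to tie-breaking).
-- Run d k q P S P' S' : starting the while loop in state (P , S), some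
-- execution terminates with final state (P' , S').
data Run {n : ℕ} (d : Fin n → Fin n → ℚ) (k q : ℕ) :
         Subset n → Subset n → Subset n → Subset n → Set where
  stop : ∀ {P S} → (Empty P ⊎ k ℕ.≤ ∣ S ∣) → Run d k q P S P S
  step : ∀ {P S P' S'} (s : Fin n) (Pnext : Subset n) →
         Nonempty P → ∣ S ∣ ℕ.< k →
         s ∈ P →
         (∀ i → i ∈ P → NR d k q s ≤ NR d k q i) →
         (∀ i → i ∈ Pnext ⇔ (i ∈ P × (NR d k q i + NR d k q i) < d i s)) →
         Run d k q Pnext (S ∪ ⁅ s ⁆) P' S' →
         Run d k q P S P' S'

IsNearestAssignment : {n : ℕ} → (Fin n → Fin n → ℚ) → (S O : Subset n) →
                      ((i : Fin n) → i ∉ O → Fin n) → Set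
IsNearestAssignment d S O σ =
  ∀ i (i∉O : i ∉ O) → (σ i i∉O ∈ S) × (∀ h → h ∈ S → d i (σ i i∉O) ≤ d i h)

record Solution (n : ℕ) : Set where
  field
    centers  : Subset n
    outliers : Subset n
    assign   : (i : Fin n) → i ∉ outliers → Fin n
    assign∈S : ∀ i (i∉O : i ∉ outliers) → assign i i∉O ∈ centers

Feasible : {n : ℕ} → ℕ → ℕ → Solution n → Set
Feasible k q sol = (∣ Solution.centers sol ∣ ℕ.≤ k) × (∣ Solution.outliers sol ∣ ℕ.≤ q)

outputSolution : {n : ℕ} (d : Fin n → Fin n → ℚ) (S O : Subset n)
                 (σ : (i : Fin n) → i ∉ O → Fin n) →
                 IsNearestAssignment d S O σ → Solution n
outputSolution d S O σ hσ = record
  { centers = S ; outliers = O ; assign = σ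
  ; assign∈S = λ i i∉O → proj₁ (hσ i i∉O) }

{-# OPTIONS --safe #-}

-- Each chosen centre s owns the ball B(s) = {j : d(s,j) ≤ NR(s)}, which has at least
-- ⌈(n-q)/k⌉ points since NR(s) is the distance to the ⌈(n-q)/k⌉-th nearest neighbour.
-- A point i that stays in P has d(i,s) > 2 NR(i) ≥ NR(i) + NR(s) (s minimises NR), so by
-- the triangle inequality it is farther than NR(i) from all of B(s). Hence the balls of
-- later centres, and the final outlier set, avoid all earlier balls. If the loop stops
-- with k centres, their disjoint balls contain k ⌈(n-q)/k⌉ ≥ n - q non-outliers.

module Submission where

open import Defs
open import Data.Nat using (ℕ; _≤_; _<_)
open import Data.Fin using (Fin)
open import Data.Fin.Subset using (Subset; ⊤; ⊥; _∉_)
open import Data.Rational using (ℚ)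

open import Data.Fin using (zero; suc)
open import Data.Fin.Subset using (_∈_; _∪_; _∩_; ⁅_⁆; ∣_∣; Empty; inside; outside)
open import Data.Fin.Subset.Properties
  using (∣⊥∣≡0; ∣⁅x⁆∣≡1; ∣p∣≤n; ∉⊥; Empty-unique; x∈p∪q⁻; x∈p∩q⁻)
open import Data.List using (List; _∷_; length; map; filter; tabulate; allFin)
open import Data.List.Membership.Propositional using () renaming (_∈_ to _∈ₗ_)
open import Data.List.Membership.Propositional.Properties using (∈-map⁻)
open import Data.List.Properties using (filter-accept; map-tabulate; length-tabulate)
open import Data.List.Relation.Binary.Permutation.Propositional.Properties
  using (↭-length; filter-↭; ∈-resp-↭)
open import Data.List.Relation.Unary.Any using (here; there)
import Data.List.Relation.Unary.All as All
open import Data.List.Relation.Unary.Linked as Linked using (Linked)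
open import Data.List.Relation.Unary.Linked.Properties using (Linked⇒All)
open import Data.Nat using (zero; suc; _+_; _*_; _∸_; NonZero; >-nonZero; z≤n; s≤s; s≤s⁻¹)
open import Data.Nat.DivMod using (_/_; _%_; m≡m%n+[m/n]*n; m%n<n; m<n*o⇒m/o<n)
open import Data.Nat.Properties
  using ( ≤-reflexive; ≤-trans; ≤-<-trans; <⇒≤; module ≤-Reasoning
        ; +-comm; +-suc; +-identityʳ; +-mono-≤; +-monoʳ-≤; +-monoˡ-≤; +-cancelˡ-≤
        ; *-comm; *-monoˡ-≤; m≤m*n; m≤m+n; m≤n+m∸n; m∸n≤m; m∸n+n≡m; ∸-monoˡ-≤; ∸-monoʳ-<)
open import Data.Product using (_×_; _,_)
open import Data.Sum using (_⊎_; inj₁; inj₂)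
open import Data.Vec using ([]; _∷_; here; there)
open import Function using (_∘_)
open import Function.Bundles using (_⇔_; Equivalence)
open import Relation.Binary.PropositionalEquality using (_≡_; refl; sym; trans; cong; subst; module ≡-Reasoning)
open import Relation.Nullary using (¬_; does; yes; no; contradiction)
open import Relation.Unary using (Pred; Decidable)
import Data.Rational as ℚ
import Data.Rational.Properties as ℚₚ
open import Data.List.Sort ℚₚ.≤-decTotalOrder using (sort; sort-↭; sort-↗)

private
  variable
    n : ℕ

select : ∀ {p} {P : Pred (Fin n) p} → Decidable P → Subset n
select {zero}  P? = []
select {suc n} P? = does (P? zero) ∷ select (P? ∘ suc)

∈-select⁻ : ∀ {p} {P : Pred (Fin n) p} (P? : Decidable P) {i} → i ∈ select P? → P i
∈-select⁻ P? {zero} i∈ with P? zero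
∈-select⁻ P? {zero} i∈ | yes Pi = Pi
∈-select⁻ P? {zero} () | no _
∈-select⁻ P? {suc i} (there i∈) = ∈-select⁻ (P? ∘ suc) i∈

∣select∣≡length-filter : ∀ {a p} {A : Set a} {P : Pred A p} (P? : Decidable P) (f : Fin n → A) →
                         ∣ select (P? ∘ f) ∣ ≡ length (filter P? (tabulate f))
∣select∣≡length-filter {zero}  P? f = refl
∣select∣≡length-filter {suc n} P? f with P? (f zero)
... | yes _ = cong suc (∣select∣≡length-filter P? (f ∘ suc))
... | no _  = ∣select∣≡length-filter P? (f ∘ suc)

∣p∪q∣+∣p∩q∣≡∣p∣+∣q∣ : (p q : Subset n) → ∣ p ∪ q ∣ + ∣ p ∩ q ∣ ≡ ∣ p ∣ + ∣ q ∣
∣p∪q∣+∣p∩q∣≡∣p∣+∣q∣ []            []            = refl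
∣p∪q∣+∣p∩q∣≡∣p∣+∣q∣ (outside ∷ p) (outside ∷ q) = ∣p∪q∣+∣p∩q∣≡∣p∣+∣q∣ p q
∣p∪q∣+∣p∩q∣≡∣p∣+∣q∣ (inside  ∷ p) (outside ∷ q) = cong suc (∣p∪q∣+∣p∩q∣≡∣p∣+∣q∣ p q)
∣p∪q∣+∣p∩q∣≡∣p∣+∣q∣ (outside ∷ p) (inside  ∷ q) =
  trans (cong suc (∣p∪q∣+∣p∩q∣≡∣p∣+∣q∣ p q)) (sym (+-suc ∣ p ∣ ∣ q ∣))
∣p∪q∣+∣p∩q∣≡∣p∣+∣q∣ (inside  ∷ p) (inside  ∷ q) = cong suc (begin
  ∣ p ∪ q ∣ + suc ∣ p ∩ q ∣   ≡⟨ +-suc ∣ p ∪ q ∣ ∣ p ∩ q ∣ ⟩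
  suc (∣ p ∪ q ∣ + ∣ p ∩ q ∣) ≡⟨ cong suc (∣p∪q∣+∣p∩q∣≡∣p∣+∣q∣ p q) ⟩
  suc (∣ p ∣ + ∣ q ∣)         ≡⟨ sym (+-suc ∣ p ∣ ∣ q ∣) ⟩
  ∣ p ∣ + suc ∣ q ∣           ∎)
  where open ≡-Reasoning

∣p∪q∣≤∣p∣+∣q∣ : (p q : Subset n) → ∣ p ∪ q ∣ ≤ ∣ p ∣ + ∣ q ∣
∣p∪q∣≤∣p∣+∣q∣ p q = ≤-trans (m≤m+n ∣ p ∪ q ∣ ∣ p ∩ q ∣) (≤-reflexive (∣p∪q∣+∣p∩q∣≡∣p∣+∣q∣ p q))

∣p∪⁅x⁆∣≤1+∣p∣ : (p : Subset n) (x : Fin n) → ∣ p ∪ ⁅ x ⁆ ∣ ≤ suc ∣ p ∣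
∣p∪⁅x⁆∣≤1+∣p∣ p x = begin
  ∣ p ∪ ⁅ x ⁆ ∣     ≤⟨ ∣p∪q∣≤∣p∣+∣q∣ p ⁅ x ⁆ ⟩
  ∣ p ∣ + ∣ ⁅ x ⁆ ∣ ≡⟨ cong (∣ p ∣ +_) (∣⁅x⁆∣≡1 x) ⟩
  ∣ p ∣ + 1         ≡⟨ +-comm ∣ p ∣ 1 ⟩
  suc ∣ p ∣         ∎
  where open ≤-Reasoning

Empty[p∩q]⇒∣p∪q∣≡∣p∣+∣q∣ : (p q : Subset n) → Empty (p ∩ q) → ∣ p ∪ q ∣ ≡ ∣ p ∣ + ∣ q ∣
Empty[p∩q]⇒∣p∪q∣≡∣p∣+∣q∣ {n} p q disjoint = begin
  ∣ p ∪ q ∣             ≡⟨ sym (+-identityʳ ∣ p ∪ q ∣) ⟩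
  ∣ p ∪ q ∣ + 0         ≡⟨ cong (∣ p ∪ q ∣ +_) (sym ∣p∩q∣≡0) ⟩
  ∣ p ∪ q ∣ + ∣ p ∩ q ∣ ≡⟨ ∣p∪q∣+∣p∩q∣≡∣p∣+∣q∣ p q ⟩
  ∣ p ∣ + ∣ q ∣         ∎
  where
  open ≡-Reasoning
  ∣p∩q∣≡0 : ∣ p ∩ q ∣ ≡ 0
  ∣p∩q∣≡0 = trans (cong ∣_∣ (Empty-unique disjoint)) (∣⊥∣≡0 n)

nth-∈ : ∀ dflt xs {m} → m < length xs → nth dflt xs m ∈ₗ xs
nth-∈ dflt (x ∷ xs) {zero}  _            = here refl
nth-∈ dflt (x ∷ xs) {suc m} (s≤s m<∣xs∣) = there (nth-∈ dflt xs m<∣xs∣)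

sorted-rank : ∀ dflt {xs} → Linked ℚ._≤_ xs → ∀ {m} → m < length xs →
              suc m ≤ length (filter (ℚ._≤? nth dflt xs m) xs)
sorted-rank dflt {x ∷ xs} sorted {zero} _ =
  subst (1 ≤_) (sym (cong length (filter-accept (ℚ._≤? x) (ℚₚ.≤-refl {x})))) (s≤s z≤n)
sorted-rank dflt {x ∷ xs} sorted {suc m} (s≤s m<∣xs∣) =
  subst (suc (suc m) ≤_) (sym (cong length (filter-accept (ℚ._≤? nth dflt xs m) x≤nth)))
        (s≤s (sorted-rank dflt (Linked.tail sorted) m<∣xs∣))
  where
  x≤nth : x ℚ.≤ nth dflt xs m
  x≤nth = All.lookup (Linked⇒All ℚₚ.≤-trans ℚₚ.≤-refl sorted) (there (nth-∈ dflt xs m<∣xs∣))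

nth-sort-∈ : ∀ dflt xs {m} → m < length xs → nth dflt (sort xs) m ∈ₗ xs
nth-sort-∈ dflt xs m<∣xs∣ =
  ∈-resp-↭ (sort-↭ xs) (nth-∈ dflt (sort xs) (subst (_ <_) (sym (↭-length (sort-↭ xs))) m<∣xs∣))

nth-sort-rank : ∀ dflt xs {m} → m < length xs →
                suc m ≤ length (filter (ℚ._≤? nth dflt (sort xs) m) xs)
nth-sort-rank dflt xs {m} m<∣xs∣ = begin
  suc m                                      ≤⟨ sorted-rank dflt (sort-↗ xs) m<∣sort-xs∣ ⟩
  length (filter (ℚ._≤? v) (sort xs))        ≡⟨ ↭-length (filter-↭ (ℚ._≤? v) (sort-↭ xs)) ⟩
  length (filter (ℚ._≤? v) xs)               ∎
  where
  open ≤-Reasoning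
  v = nth dflt (sort xs) m
  m<∣sort-xs∣ : m < length (sort xs)
  m<∣sort-xs∣ = subst (m <_) (sym (↭-length (sort-↭ xs))) m<∣xs∣

⌈m/n⌉≤m : ∀ m n .{{_ : NonZero n}} → ⌈ m / n ⌉ ≤ m
⌈m/n⌉≤m m (suc n) = s≤s⁻¹ (m<n*o⇒m/o<n (s≤s (begin
  m + n         ≡⟨ +-comm m n ⟩
  n + m         ≤⟨ +-monoʳ-≤ n (m≤m*n m (suc n)) ⟩
  n + m * suc n ∎)))
  where open ≤-Reasoning

m≤n*⌈m/n⌉ : ∀ m n .{{_ : NonZero n}} → m ≤ n * ⌈ m / n ⌉
m≤n*⌈m/n⌉ m (suc n) = +-cancelˡ-≤ n m (suc n * c) (begin
  n + m                       ≡⟨ +-comm n m ⟩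
  m + n                       ≡⟨ m≡m%n+[m/n]*n (m + n) (suc n) ⟩
  (m + n) % suc n + c * suc n ≤⟨ +-mono-≤ (s≤s⁻¹ (m%n<n (m + n) (suc n))) (≤-reflexive (*-comm c (suc n))) ⟩
  n + suc n * c               ∎)
  where
  open ≤-Reasoning
  c = (m + n) / suc n

module _ {d : Fin n → Fin n → ℚ} {k q : ℕ} where

  run-centers≤k : ∀ {P S O S′} → Run d k q P S O S′ → ∣ S ∣ ≤ k → ∣ S′ ∣ ≤ k
  run-centers≤k (stop _) ∣S∣≤k = ∣S∣≤k
  run-centers≤k {S = S} (step s _ _ ∣S∣<k _ _ _ run) _ =
    run-centers≤k run (≤-trans (∣p∪⁅x⁆∣≤1+∣p∣ S s) ∣S∣<k)

  run-exit : ∀ {P S O S′} → Run d k q P S O S′ → Empty O ⊎ k ≤ ∣ S′ ∣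
  run-exit (stop exit)              = exit
  run-exit (step _ _ _ _ _ _ _ run) = run-exit run

<⇒≱ : ∀ {x y} → x ℚ.< y → ¬ y ℚ.≤ x
<⇒≱ x<y y≤x = ℚₚ.<-irrefl refl (ℚₚ.<-≤-trans x<y y≤x)

-- The bound on the rank keeps NR a genuine distance rather than the default value of nth.
module Algorithm2 (d : Fin n → Fin n → ℚ) (metric : IsMetric d) (k q : ℕ)
                  (rank∸1<n : ⌈ (n ∸ q) / k ⌉ ∸ 1 < n) where
  open IsMetric metric

  rank : ℕ
  rank = ⌈ (n ∸ q) / k ⌉

  radius : Fin n → ℚ
  radius = NR d k q

  ball : Fin n → Subset n
  ball s = select (λ j → d s j ℚ.≤? radius s)

  distances : Fin n → List ℚ
  distances i = map (d i) (allFin n)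

  distances≡tabulate : ∀ i → distances i ≡ tabulate (d i)
  distances≡tabulate i = map-tabulate (λ j → j) (d i)

  rank∸1<∣distances∣ : ∀ i → rank ∸ 1 < length (distances i)
  rank∸1<∣distances∣ i =
    subst (rank ∸ 1 <_) (sym (trans (cong length (distances≡tabulate i)) (length-tabulate (d i)))) rank∸1<n

  radius-nonneg : ∀ i → ℚ.0ℚ ℚ.≤ radius i
  radius-nonneg i with ∈-map⁻ (d i) (nth-sort-∈ ℚ.0ℚ (distances i) (rank∸1<∣distances∣ i))
  ... | j , _ , radius≡dij = subst (ℚ.0ℚ ℚ.≤_) (sym radius≡dij) (nonneg i j)

  rank≤∣ball∣ : ∀ s → rank ≤ ∣ ball s ∣
  rank≤∣ball∣ s = begin
    rank                                                ≤⟨ m≤n+m∸n rank 1 ⟩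
    suc (rank ∸ 1)                                      ≤⟨ nth-sort-rank ℚ.0ℚ (distances s) (rank∸1<∣distances∣ s) ⟩
    length (filter (ℚ._≤? radius s) (distances s))      ≡⟨ cong (length ∘ filter (ℚ._≤? radius s)) (distances≡tabulate s) ⟩
    length (filter (ℚ._≤? radius s) (tabulate (d s)))   ≡⟨ sym (∣select∣≡length-filter (ℚ._≤? radius s) (d s)) ⟩
    ∣ ball s ∣                                          ∎
    where open ≤-Reasoning

  Far : Subset n → Subset n → Set
  Far P U = ∀ {i j} → i ∈ P → j ∈ U → radius i ℚ.< d i j

  far⇒disjoint : ∀ {P U} → Far P U → Empty (U ∩ P)
  far⇒disjoint {P} {U} far (i , i∈U∩P) with x∈p∩q⁻ U P i∈U∩P
  ... | i∈U , i∈P = <⇒≱ (subst (radius i ℚ.<_) (refl0 i) (far i∈P i∈U)) (radius-nonneg i)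

  ball-disjoint : ∀ {P U s} → Far P U → s ∈ P → Empty (U ∩ ball s)
  ball-disjoint {U = U} {s} far s∈P (j , j∈U∩B) with x∈p∩q⁻ U (ball s) j∈U∩B
  ... | j∈U , j∈B = <⇒≱ (far s∈P j∈U) (∈-select⁻ _ j∈B)

  far-step : ∀ {P P′ U s} → Far P U →
             (∀ i → i ∈ P → radius s ℚ.≤ radius i) →
             (∀ i → i ∈ P′ ⇔ (i ∈ P × (radius i ℚ.+ radius i) ℚ.< d i s)) →
             Far P′ (U ∪ ball s)
  far-step {U = U} {s} far minimal P′-spec {i} {j} i∈P′ j∈U∪B
    with Equivalence.to (P′-spec i) i∈P′ | x∈p∪q⁻ U (ball s) j∈U∪B
  ... | i∈P , _         | inj₁ j∈U = far i∈P j∈U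
  ... | i∈P , 2r<d[i,s] | inj₂ j∈B = ℚₚ.≰⇒> λ d[i,j]≤r → <⇒≱ 2r<d[i,s] (begin
    d i s                   ≤⟨ tri i j s ⟩
    d i j ℚ.+ d j s         ≤⟨ ℚₚ.+-mono-≤ d[i,j]≤r d[j,s]≤r ⟩
    radius i ℚ.+ radius i   ∎)
    where
    open ℚₚ.≤-Reasoning
    d[j,s]≤r : d j s ℚ.≤ radius i
    d[j,s]≤r = begin
      d j s     ≡⟨ symm j s ⟩
      d s j     ≤⟨ ∈-select⁻ _ j∈B ⟩
      radius s  ≤⟨ minimal i i∈P ⟩
      radius i  ∎

  -- covered is the union of the balls of the centres chosen so far.
  record Invariant (P S : Subset n) : Set where
    field
      covered : Subset n
      far     : Far P covered
      size    : ∣ S ∣ * rank ≤ ∣ covered ∣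

  initial : Invariant ⊤ ⊥
  initial = record
    { covered = ⊥
    ; far     = λ _ j∈⊥ → contradiction j∈⊥ ∉⊥
    ; size    = subst (λ c → c * rank ≤ c) (sym (∣⊥∣≡0 n)) z≤n
    }

  run-invariant : ∀ {P S O S′} → Run d k q P S O S′ → Invariant P S → Invariant O S′
  run-invariant (stop _) inv = inv
  run-invariant {S = S} (step s _ _ _ s∈P minimal P′-spec run) inv = run-invariant run record
    { covered = covered ∪ ball s
    ; far     = far-step far minimal P′-spec
    ; size    = begin
        ∣ S ∪ ⁅ s ⁆ ∣ * rank       ≤⟨ *-monoˡ-≤ rank (∣p∪⁅x⁆∣≤1+∣p∣ S s) ⟩
        rank + ∣ S ∣ * rank        ≤⟨ +-mono-≤ (rank≤∣ball∣ s) size ⟩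
        ∣ ball s ∣ + ∣ covered ∣   ≡⟨ +-comm ∣ ball s ∣ ∣ covered ∣ ⟩
        ∣ covered ∣ + ∣ ball s ∣   ≡⟨ sym (Empty[p∩q]⇒∣p∪q∣≡∣p∣+∣q∣ covered (ball s) (ball-disjoint far s∈P)) ⟩
        ∣ covered ∪ ball s ∣       ∎
    }
    where
    open Invariant inv
    open ≤-Reasoning

  outliers≤q : ∀ {O S} → q ≤ n → n ∸ q ≤ k * rank →
               Invariant O S → Empty O ⊎ k ≤ ∣ S ∣ → ∣ O ∣ ≤ q
  outliers≤q _ _ _ (inj₁ empty) =
    subst (_≤ q) (sym (trans (cong ∣_∣ (Empty-unique empty)) (∣⊥∣≡0 n))) z≤n
  outliers≤q {O} {S} q≤n n∸q≤k*rank inv (inj₂ k≤∣S∣) = +-cancelˡ-≤ (n ∸ q) ∣ O ∣ q (begin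
    n ∸ q + ∣ O ∣           ≤⟨ +-monoˡ-≤ ∣ O ∣ n∸q≤∣covered∣ ⟩
    ∣ covered ∣ + ∣ O ∣     ≡⟨ sym (Empty[p∩q]⇒∣p∪q∣≡∣p∣+∣q∣ covered O (far⇒disjoint far)) ⟩
    ∣ covered ∪ O ∣         ≤⟨ ∣p∣≤n (covered ∪ O) ⟩
    n                       ≡⟨ sym (m∸n+n≡m q≤n) ⟩
    n ∸ q + q               ∎)
    where
    open Invariant inv
    open ≤-Reasoning
    n∸q≤∣covered∣ : n ∸ q ≤ ∣ covered ∣
    n∸q≤∣covered∣ = begin
      n ∸ q        ≤⟨ n∸q≤k*rank ⟩
      k * rank     ≤⟨ *-monoˡ-≤ rank k≤∣S∣ ⟩
      ∣ S ∣ * rank ≤⟨ size ⟩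
      ∣ covered ∣  ∎

lemma2 : (n : ℕ) (d : Fin n → Fin n → ℚ) (k q : ℕ) →
    1 ≤ n → IsMetric d → 1 ≤ k → q < n →
    (S O : Subset n) → Run d k q ⊤ ⊥ O S →
    (σ : (i : Fin n) → i ∉ O → Fin n) →
    (hσ : IsNearestAssignment d S O σ) →
    Feasible k q (outputSolution d S O σ hσ)
lemma2 n d k q 1≤n metric 1≤k q<n _ _ run _ _ =
  run-centers≤k run (subst (_≤ k) (sym (∣⊥∣≡0 n)) z≤n) ,
  outliers≤q (<⇒≤ q<n) (m≤n*⌈m/n⌉ (n ∸ q) k) (run-invariant run initial) (run-exit run)
  where
  instance
    k≢0 : NonZero k
    k≢0 = >-nonZero 1≤k
  rank∸1<n : ⌈ (n ∸ q) / k ⌉ ∸ 1 < n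
  rank∸1<n = ≤-<-trans (∸-monoˡ-≤ 1 (≤-trans (⌈m/n⌉≤m (n ∸ q) k) (m∸n≤m n q))) (∸-monoʳ-< (s≤s z≤n) 1≤n)
  open Algorithm2 d metric k q rank∸1<n
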